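{- Let $p<q$ be distinct primes. Then the zero-divisor graph $\Gamma(\mathbb{Z}_{p^2q^2})$ is not Hamiltonian.
   Context: For a finite commutative ring $R$ with unity, the zero-divisor graph $\Gamma(R)$ has vertex set the nonzero zero-divisors of $R$, with distinct $x,y$ adjacent iff $xy=0$. A graph of order $N$ is Hamiltonian if it contains a cycle of length $N$. -}

module Defs where

open import Data.Nat using (ℕ; suc; _*_; _≤_)
open import Data.Nat.Divisibility using (_∣_)
open import Data.Fin using (Fin; toℕ)
open import Data.List using (List; []; _∷_; length)
open import Data.List.Membership.Propositional using (_∈_)
open import Data.List.Relation.Unary.Unique.Propositional using (Unique)
open import Data.Product using (Σ; ∃; _×_; _,_)
open import Relation.Binary.PropositionalEquality using (_≡_)
open import Relation.Nullary using (¬_)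

-- The ring ℤ_n, represented by residues 0..n-1 (Fin n);
-- we only need multiplication and the zero test.
-- x and y in ℤ_n multiply to zero iff n divides x * y (as naturals).
MulZero : (n : ℕ) → Fin n → Fin n → Set
MulZero n x y = n ∣ toℕ x * toℕ y

Nonzero : {n : ℕ} → Fin n → Set
Nonzero x = ¬ (toℕ x ≡ 0)

IsVertex : (n : ℕ) → Fin n → Set
IsVertex n x = Nonzero x × ∃ λ (y : Fin n) → Nonzero y × MulZero n x y

Adj : (n : ℕ) → Fin n → Fin n → Set
Adj n x y = IsVertex n x × IsVertex n y × ¬ (x ≡ y) × MulZero n x y

-- Consecutive elements of a (nonempty) list are adjacent, and the last is
-- adjacent to the head `h` (closing the cycle).
-- ChainTo n h l : for l = v₀ ∷ v₁ ∷ … ∷ vₖ, each vᵢ ~ vᵢ₊₁ and vₖ ~ h.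
data ChainTo (n : ℕ) (h : Fin n) : List (Fin n) → Set where
  last : ∀ {v} → Adj n v h → ChainTo n h (v ∷ [])
  step : ∀ {v w vs} → Adj n v w → ChainTo n h (w ∷ vs) → ChainTo n h (v ∷ w ∷ vs)

record HamiltonianCycle (n : ℕ) : Set where
  field
    h        : Fin n
    rest     : List (Fin n)
    distinct : Unique (h ∷ rest)
    covers   : ∀ x → IsVertex n x → x ∈ (h ∷ rest)
    onlyVert : ∀ x → x ∈ (h ∷ rest) → IsVertex n x
    long     : 3 ≤ length (h ∷ rest)
    cycle    : ChainTo n h (h ∷ rest)

Hamiltonian : (n : ℕ) → Set
Hamiltonian n = HamiltonianCycle n

module Submission where

-- Write n = p²q² and t = pq², and call x "p-exact" when p divides x exactly
-- once and q ∤ x, i.e. x = pk with p ∤ k and q ∤ k.  Then k is invertible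
-- modulo pq², so n ∣ xy forces t ∣ y: every neighbour of a p-exact vertex is a
-- nonzero multiple of t.
--
-- Along a Hamiltonian cycle every p-exact vertex is followed by a multiple of
-- t, and distinct vertices have distinct successors, so the cycle contains at
-- least as many multiples of t as p-exact vertices.  But the nonzero multiples
-- of t below n = p·t are t, 2t, …, (p-1)t, only p - 1 of them, while the p
-- numbers p(1 + i·pq) for i < p are distinct p-exact vertices (each is killed
-- by t).  Hence p ≤ p - 1, a contradiction.

open import Defs
open import Data.Nat using (ℕ; _<_; _*_)
open import Data.Nat.Primality using (Prime)
open import Relation.Nullary using (¬_)

open import Data.Nat
  using (zero; suc; pred; _≤_; z≤n; s≤s; NonZero; ≢-nonZero⁻¹; >-nonZero⁻¹; nonTrivial⇒n>1)
open import Data.Nat.Properties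
open import Data.Nat.Divisibility
open import Data.Nat.Primality using (euclidsLemma; prime⇒nonZero; prime⇒nonTrivial)
open import Data.Nat.Tactic.RingSolver using (solve-∀)
open import Data.Fin using (Fin; toℕ; fromℕ<)
open import Data.Fin.Properties using (toℕ-injective; toℕ-fromℕ<; toℕ<n)
open import Data.List using (List; []; _∷_; _∷ʳ_; length; filter; map; applyUpTo)
open import Data.List.Properties using (filter-accept; length-map; length-applyUpTo)
open import Data.List.Membership.Propositional using (_∈_)
open import Data.List.Membership.Propositional.Properties
  using (∈-map⁺; ∈-map⁻; ∈-filter⁺; ∈-filter⁻; ∈-applyUpTo⁺; ∈-applyUpTo⁻)
open import Data.List.Relation.Binary.Subset.Propositional using (_⊆_)
open import Data.List.Relation.Binary.Permutation.Propositional using (↭-sym)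
open import Data.List.Relation.Binary.Permutation.Propositional.Properties
  using (↭-length; filter-↭; ∷↭∷ʳ)
open import Data.List.Relation.Unary.Any using (here; there)
open import Data.List.Relation.Unary.All using (lookup)
open import Data.List.Relation.Unary.Unique.Propositional using (Unique; _∷_)
import Data.List.Relation.Unary.Unique.Propositional.Properties as Unique
open import Data.Product using (_×_; _,_; proj₁)
open import Data.Sum using (inj₁; inj₂)
open import Function using (_∘_)
open import Level using (0ℓ)
open import Relation.Binary.Definitions using (DecidableEquality)
open import Relation.Binary.PropositionalEquality
open import Relation.Nullary using (Dec; yes; no; contradiction)
open import Relation.Nullary.Decidable using (_×-dec_; ¬?)
open import Relation.Unary using (Pred; Decidable)

-- Pigeonhole principle for lists: a duplicate-free list contained in ys is no
-- longer than ys.  Proved by deleting, one at a time, the elements of the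
-- small list from the large one.
module DuplicateFree {A : Set} (_≟_ : DecidableEquality A) where

  remove : A → List A → List A
  remove x [] = []
  remove x (y ∷ ys) with x ≟ y
  ... | yes _ = ys
  ... | no _  = y ∷ remove x ys

  length-remove : ∀ {x ys} → x ∈ ys → suc (length (remove x ys)) ≡ length ys
  length-remove {x} {y ∷ ys} (here refl) with x ≟ x
  ... | yes _ = refl
  ... | no x≢x = contradiction refl x≢x
  length-remove {x} {y ∷ ys} (there x∈ys) with x ≟ y
  ... | yes _ = refl
  ... | no _  = cong suc (length-remove x∈ys)

  ∈-remove : ∀ {x z ys} → z ∈ ys → z ≢ x → z ∈ remove x ys
  ∈-remove {x} {z} {y ∷ ys} (here refl) z≢x with x ≟ y
  ... | yes x≡z = contradiction (sym x≡z) z≢x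
  ... | no _    = here refl
  ∈-remove {x} {z} {y ∷ ys} (there z∈ys) z≢x with x ≟ y
  ... | yes _ = z∈ys
  ... | no _  = there (∈-remove z∈ys z≢x)

  unique⊆⇒length≤ : ∀ {xs ys} → Unique xs → xs ⊆ ys → length xs ≤ length ys
  unique⊆⇒length≤ {[]}     _              _  = z≤n
  unique⊆⇒length≤ {x ∷ xs} (x∉xs ∷ uniq) xs⊆ys =
    subst (suc (length xs) ≤_) (length-remove (xs⊆ys (here refl)))
      (s≤s (unique⊆⇒length≤ uniq λ z∈xs →
        ∈-remove (xs⊆ys (there z∈xs)) (λ z≡x → lookup x∉xs z∈xs (sym z≡x))))

open DuplicateFree _≟_ using (unique⊆⇒length≤)

-- Counting along a cycle of Γ(ℤ_n): if every vertex satisfying P is adjacent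
-- only to vertices satisfying Q, then a cycle passes through at least as many
-- Q-vertices as P-vertices, because the successor of each P-vertex on the
-- cycle is a Q-vertex and successors of distinct positions are distinct.
module CycleCount (n : ℕ) {P Q : Pred (Fin n) 0ℓ} (P? : Decidable P) (Q? : Decidable Q)
                  (adj-P⇒Q : ∀ {a b} → Adj n a b → P a → Q b) where

  -- Along an open path v ∷ vs closed up by h, the P-vertices are matched with
  -- their successors, which lie in the shifted list vs ∷ʳ h.
  path-count : ∀ {h v vs} → ChainTo n h (v ∷ vs) →
               length (filter P? (v ∷ vs)) ≤ length (filter Q? (vs ∷ʳ h))
  path-count {h} {v} (last v~h) with P? v
  ... | yes Pv rewrite filter-accept Q? {h} {[]} (adj-P⇒Q v~h Pv) = ≤-refl
  ... | no _   = z≤n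
  path-count {h} {v} {w ∷ vs} (step v~w chain) with P? v
  ... | yes Pv rewrite filter-accept Q? {w} {vs ∷ʳ h} (adj-P⇒Q v~w Pv) =
    s≤s (path-count chain)
  ... | no _   = ≤-trans (path-count chain) (count-∷ w (vs ∷ʳ h))
    where
    count-∷ : ∀ x xs → length (filter Q? xs) ≤ length (filter Q? (x ∷ xs))
    count-∷ x xs with Q? x
    ... | yes _ = n≤1+n _
    ... | no _  = ≤-refl

  -- On a closed cycle the shifted list is a rotation, so has the same count.
  cycle-count : ∀ {h rest} → ChainTo n h (h ∷ rest) →
                length (filter P? (h ∷ rest)) ≤ length (filter Q? (h ∷ rest))
  cycle-count {h} {rest} chain =
    subst (length (filter P? (h ∷ rest)) ≤_)
      (↭-length (filter-↭ Q? (↭-sym (∷↭∷ʳ h rest))))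
      (path-count chain)

Cancels : ℕ → ℕ → Set
Cancels d k = ∀ y → d ∣ k * y → d ∣ y

prime-cancels : ∀ {r k} → Prime r → ¬ r ∣ k → Cancels r k
prime-cancels {r} {k} r-prime r∤k y r∣ky with euclidsLemma k y r-prime r∣ky
... | inj₁ r∣k = contradiction r∣k r∤k
... | inj₂ r∣y = r∣y

*-prime-cancels : ∀ {r d k} → Prime r → ¬ r ∣ k → Cancels d k → Cancels (r * d) k
*-prime-cancels {r} {d} {k} r-prime r∤k d-cancels y rd∣ky
  with prime-cancels r-prime r∤k y (∣-trans (m∣m*n d) rd∣ky)
... | divides y′ refl =
  subst (r * d ∣_) (*-comm r y′) (*-monoʳ-∣ r (d-cancels y′ d∣ky′))
  where
  rearrange : ∀ k y′ r → k * (y′ * r) ≡ r * (k * y′)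
  rearrange = solve-∀
  d∣ky′ : d ∣ k * y′
  d∣ky′ = *-cancelˡ-∣ r {{prime⇒nonZero r-prime}}
            (subst (r * d ∣_) (rearrange k y′ r) rd∣ky)

PExact : ℕ → ℕ → ℕ → Set
PExact p q x = p ∣ x × ¬ (p * p ∣ x) × ¬ (q ∣ x)

pExact? : ∀ p q x → Dec (PExact p q x)
pExact? p q x = (p ∣? x) ×-dec ¬? (p * p ∣? x) ×-dec ¬? (q ∣? x)

-- The key fact: if x is p-exact then x·y ≡ 0 (mod p²q²) forces pq² ∣ y,
-- since x = pk with k invertible modulo pq².
pExact-annihilator : ∀ {p q x y} → Prime p → Prime q → PExact p q x →
                     p * p * (q * q) ∣ x * y → p * (q * q) ∣ y
pExact-annihilator {p} {q} {_} {y} p-prime q-prime (divides k refl , p²∤x , q∤x) n∣xy =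
  k-cancels y (*-cancelˡ-∣ p {{prime⇒nonZero p-prime}}
                 (subst₂ _∣_ (*-assoc p p (q * q)) (rearrange k p y) n∣xy))
  where
  rearrange : ∀ k p y → k * p * y ≡ p * (k * y)
  rearrange = solve-∀
  p∤k : ¬ p ∣ k
  p∤k p∣k = p²∤x (*-pres-∣ p∣k (∣-refl {p}))
  q∤k : ¬ q ∣ k
  q∤k q∣k = q∤x (∣m⇒∣m*n p q∣k)
  k-cancels : Cancels (p * (q * q)) k
  k-cancels = *-prime-cancels p-prime p∤k
                (*-prime-cancels q-prime q∤k (prime-cancels q-prime q∤k))

¬∣-consecutive : ∀ {r m} → 1 < r → r ∣ m → ¬ r ∣ suc m
¬∣-consecutive {r} {m} 1<r r∣m r∣1+m =
  <⇒≢ 1<r (sym (∣1⇒≡1 (∣m+n∣m⇒∣n (subst (r ∣_) (+-comm 1 m) r∣1+m) r∣m)))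

nonzero-multiple∈ : ∀ {c d y} → d ∣ y → y ≢ 0 → y < c * d →
                    y ∈ applyUpTo (λ j → suc j * d) (pred c)
nonzero-multiple∈ (divides zero refl) y≢0 _ = contradiction refl y≢0
nonzero-multiple∈ {c} {d} (divides (suc j) refl) _ y<cd =
  ∈-applyUpTo⁺ (λ j → suc j * d) (suc[m]≤n⇒m≤pred[n] (*-cancelʳ-< d (suc j) c y<cd))

vertex : ∀ {n x y} (x<n : x < n) (y<n : y < n) → x ≢ 0 → y ≢ 0 → n ∣ x * y →
         IsVertex n (fromℕ< x<n)
vertex {n} x<n y<n x≢0 y≢0 n∣xy =
    (λ x≡0 → x≢0 (trans (sym (toℕ-fromℕ< x<n)) x≡0))
  , fromℕ< y<n
  , (λ y≡0 → y≢0 (trans (sym (toℕ-fromℕ< y<n)) y≡0))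
  , subst₂ (λ a b → n ∣ a * b) (sym (toℕ-fromℕ< x<n)) (sym (toℕ-fromℕ< y<n)) n∣xy

module SquareOfSemiprime (p q : ℕ) (p-prime : Prime p) (q-prime : Prime q) (p<q : p < q) where

  n t : ℕ
  n = p * p * (q * q)
  t = p * (q * q)

  instance
    p≢0 : NonZero p
    p≢0 = prime⇒nonZero p-prime
    q≢0 : NonZero q
    q≢0 = prime⇒nonZero q-prime
    pq≢0 : NonZero (p * q)
    pq≢0 = m*n≢0 p q
    qq≢0 : NonZero (q * q)
    qq≢0 = m*n≢0 q q
    t≢0 : NonZero t
    t≢0 = m*n≢0 p (q * q)

  1<p : 1 < p
  1<p = nonTrivial⇒n>1 p {{prime⇒nonTrivial p-prime}}

  n≡p*t : n ≡ p * t
  n≡p*t = *-assoc p p (q * q)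

  t<n : t < n
  t<n = subst (t <_) (trans (*-comm t p) (sym n≡p*t)) (m<m*n t p 1<p)

  witness : ℕ → ℕ
  witness i = p * suc (i * (p * q))

  witness-pExact : ∀ i → PExact p q (witness i)
  witness-pExact i = m∣m*n _ , p²∤ , q∤
    where
    p∣ipq : p ∣ i * (p * q)
    p∣ipq = ∣-trans (m∣m*n q) (n∣m*n i)
    q∣ipq : q ∣ i * (p * q)
    q∣ipq = ∣-trans (n∣m*n p) (n∣m*n i)
    p²∤ : ¬ p * p ∣ witness i
    p²∤ p²∣ = ¬∣-consecutive 1<p p∣ipq (*-cancelˡ-∣ p p²∣)
    q∤ : ¬ q ∣ witness i
    q∤ q∣ with euclidsLemma p _ q-prime q∣
    ... | inj₁ q∣p   = <⇒≱ p<q (∣⇒≤ q∣p)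
    ... | inj₂ q∣1+m = ¬∣-consecutive (<-trans 1<p p<q) q∣ipq q∣1+m

  witness-injective : ∀ {i j} → witness i ≡ witness j → i ≡ j
  witness-injective {i} {j} eq =
    *-cancelʳ-≡ i j (p * q) (suc-injective (*-cancelˡ-≡ _ _ p eq))

  witness<n : ∀ {i} → i < p → witness i < n
  witness<n {i} i<p = subst (witness i <_) (sym n≡p*t) (*-monoʳ-< p bound)
    where
    bound : suc (i * (p * q)) < t
    bound = begin-strict
      suc (i * (p * q))     ≤⟨ +-monoˡ-≤ _ (>-nonZero⁻¹ (p * q)) ⟩
      suc i * (p * q)       ≤⟨ *-monoˡ-≤ (p * q) i<p ⟩
      p * (p * q)           <⟨ *-monoˡ-< (p * q) p<q ⟩
      q * (p * q)           ≡⟨ regroup p q ⟩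
      t                     ∎
      where
      open ≤-Reasoning
      regroup : ∀ p q → q * (p * q) ≡ p * (q * q)
      regroup = solve-∀

  witness-vertex : ∀ {i} (i<p : i < p) → IsVertex n (fromℕ< (witness<n i<p))
  witness-vertex {i} i<p =
    vertex (witness<n i<p) t<n (≢-nonZero⁻¹ (witness i) {{m*n≢0 p _}}) (≢-nonZero⁻¹ t)
      (divides (suc (i * (p * q))) (regroup p q _))
    where
    regroup : ∀ p q m → p * m * (p * (q * q)) ≡ m * (p * p * (q * q))
    regroup = solve-∀

  isPExact? : Decidable {A = Fin n} (λ x → PExact p q (toℕ x))
  isPExact? x = pExact? p q (toℕ x)

  isMultipleOfT? : Decidable {A = Fin n} (λ x → t ∣ toℕ x)
  isMultipleOfT? x = t ∣? toℕ x

  open CycleCount n isPExact? isMultipleOfT?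
         (λ (_ , _ , _ , n∣xy) x-exact → pExact-annihilator p-prime q-prime x-exact n∣xy)
    public using (cycle-count)

  module _ (H : HamiltonianCycle n) where
    open HamiltonianCycle H

    pExact-count : p ≤ length (filter isPExact? (h ∷ rest))
    pExact-count =
      subst₂ _≤_ (length-applyUpTo witness p) (length-map toℕ (filter isPExact? (h ∷ rest)))
        (unique⊆⇒length≤ (Unique.applyUpTo⁺₁ witness p distinct-witnesses) witnesses⊆)
      where
      distinct-witnesses : ∀ {i j} → i < j → j < p → witness i ≢ witness j
      distinct-witnesses i<j _ = <⇒≢ i<j ∘ witness-injective
      witnesses⊆ : applyUpTo witness p ⊆ map toℕ (filter isPExact? (h ∷ rest))
      witnesses⊆ w∈ with ∈-applyUpTo⁻ witness w∈
      ... | i , i<p , refl =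
        subst (_∈ map toℕ (filter isPExact? (h ∷ rest))) (toℕ-fromℕ< (witness<n i<p))
          (∈-map⁺ toℕ (∈-filter⁺ isPExact? (covers _ (witness-vertex i<p))
            (subst (PExact p q) (sym (toℕ-fromℕ< (witness<n i<p))) (witness-pExact i))))

    -- The multiples of t on the cycle are nonzero and below n = p·t.
    multiple-count : length (filter isMultipleOfT? (h ∷ rest)) ≤ pred p
    multiple-count =
      subst₂ _≤_ (length-map toℕ (filter isMultipleOfT? (h ∷ rest)))
                 (length-applyUpTo (λ j → suc j * t) (pred p))
        (unique⊆⇒length≤
          (Unique.map⁺ toℕ-injective (Unique.filter⁺ isMultipleOfT? distinct))
          multiples⊆)
      where
      multiples⊆ : map toℕ (filter isMultipleOfT? (h ∷ rest))
                   ⊆ applyUpTo (λ j → suc j * t) (pred p)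
      multiples⊆ y∈ with ∈-map⁻ toℕ y∈
      ... | y , y∈L , refl with ∈-filter⁻ isMultipleOfT? y∈L
      ... | y∈cycle , t∣y =
        nonzero-multiple∈ {c = p} t∣y (proj₁ (onlyVert y y∈cycle))
          (subst (toℕ y <_) n≡p*t (toℕ<n y))

theorem2p8 : (p q : ℕ) → Prime p → Prime q → p < q →
    ¬ Hamiltonian ((p * p) * (q * q))
theorem2p8 p q p-prime q-prime p<q H =
  <-irrefl refl (m≤pred[n]⇒suc[m]≤n {{prime⇒nonZero p-prime}} p≤p-1)
  where
  open SquareOfSemiprime p q p-prime q-prime p<q
  open HamiltonianCycle H using (h; rest; cycle)
  p≤p-1 : p ≤ pred p
  p≤p-1 = begin
    p                                           ≤⟨ pExact-count H ⟩
    length (filter isPExact? (h ∷ rest))        ≤⟨ cycle-count cycle ⟩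
    length (filter isMultipleOfT? (h ∷ rest))   ≤⟨ multiple-count H ⟩
    pred p                                      ∎
    where open ≤-Reasoning
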